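{- Assume Schinzel's Hypothesis H. Then there are infinitely many primes that are both Brazilian primes and Sophie Germain primes.
   Context: A positive integer $n$ is Brazilian if there is an integer $b$ with $1<b<n-1$ such that all digits of the base-$b$ representation of $n$ are equal; equivalently $n = m\frac{b^q-1}{b-1}$ for some integers $1\le m<b$, $q\ge 2$ and $1<b<n-1$. A Brazilian prime is a Brazilian number that is prime. A Sophie Germain prime is a prime $p$ such that $2p+1$ is also prime. Schinzel's Hypothesis H: if $f_1,\dots,f_k\in\mathbb{Z}[x]$ are irreducible polynomials with positive leading coefficients such that for every prime $\ell$ there is an integer $n$ with $\ell\nmid f_1(n)\cdots f_k(n)$, then there are infinitely many positive integers $n$ such that $f_1(n),\dots,f_k(n)$ are all prime. -}

module Defs where

open import Data.Nat as ℕ using (ℕ; zero; suc)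
open import Data.Nat.Primality using (Prime)
open import Data.Integer as ℤ using (ℤ; +_; 0ℤ; 1ℤ; -1ℤ)
open import Data.Integer.Divisibility as ℤD using ()
open import Data.List using (List; []; _∷_; map; foldr)
open import Data.List.Relation.Unary.All using (All)
open import Data.Product using (Σ; ∃; _×_; _,_)
open import Data.Sum using (_⊎_)
open import Relation.Nullary using (¬_; yes; no)
open import Relation.Binary.PropositionalEquality using (_≡_)

repunit : ℕ → ℕ → ℕ
repunit b zero    = 0
repunit b (suc q) = b ℕ.^ q ℕ.+ repunit b q

-- n = m (b^q - 1)/(b - 1) with 1 ≤ m < b, q ≥ 2, 1 < b < n - 1
-- (i.e. n is written with q equal digits m in base b)
Brazilian : ℕ → Set
Brazilian n = Σ ℕ λ b → Σ ℕ λ m → Σ ℕ λ q →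
  (1 ℕ.< b) × (b ℕ.< n ℕ.∸ 1) × (1 ℕ.≤ m) × (m ℕ.< b) × (2 ℕ.≤ q)
  × (n ≡ m ℕ.* repunit b q)

BrazilianPrime : ℕ → Set
BrazilianPrime n = Brazilian n × Prime n

SophieGermainPrime : ℕ → Set
SophieGermainPrime p = Prime p × Prime (2 ℕ.* p ℕ.+ 1)

-- Polynomials in ℤ[x], as coefficient lists (constant term first)

Poly : Set
Poly = List ℤ

coeff : Poly → ℕ → ℤ
coeff []      _       = 0ℤ
coeff (a ∷ f) zero    = a
coeff (a ∷ f) (suc i) = coeff f i

-- equality in ℤ[x]: equal coefficients (trailing zeros irrelevant)
_≈ₚ_ : Poly → Poly → Set
f ≈ₚ g = ∀ i → coeff f i ≡ coeff g i

_+ₚ_ : Poly → Poly → Poly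
[]      +ₚ g       = g
(a ∷ f) +ₚ []      = a ∷ f
(a ∷ f) +ₚ (b ∷ g) = (a ℤ.+ b) ∷ (f +ₚ g)

_*ₚ_ : Poly → Poly → Poly
[]      *ₚ g = []
(a ∷ f) *ₚ g = map (a ℤ.*_) g +ₚ (0ℤ ∷ (f *ₚ g))

eval : Poly → ℤ → ℤ
eval []      x = 0ℤ
eval (a ∷ f) x = a ℤ.+ x ℤ.* eval f x

-- leading coefficient (last nonzero coefficient; 0 for the zero polynomial)
lead : Poly → ℤ
lead [] = 0ℤ
lead (a ∷ f) with lead f ℤ.≟ 0ℤ
... | yes _ = a
... | no  _ = lead f

IsZeroPoly : Poly → Set
IsZeroPoly f = ∀ i → coeff f i ≡ 0ℤ

-- units of ℤ[x] are the constants ±1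
IsUnitPoly : Poly → Set
IsUnitPoly f = (coeff f 0 ≡ 1ℤ ⊎ coeff f 0 ≡ -1ℤ) × (∀ i → coeff f (suc i) ≡ 0ℤ)

Irreducible : Poly → Set
Irreducible f = ¬ IsZeroPoly f × ¬ IsUnitPoly f
  × (∀ g h → f ≈ₚ (g *ₚ h) → IsUnitPoly g ⊎ IsUnitPoly h)

IsPrimeℤ : ℤ → Set
IsPrimeℤ z = Σ ℕ λ p → (z ≡ + p) × Prime p

evalProd : List Poly → ℤ → ℤ
evalProd fs x = foldr (λ f acc → eval f x ℤ.* acc) 1ℤ fs

HypothesisH : Set
HypothesisH = (fs : List Poly) →
  All Irreducible fs →
  All (λ f → 0ℤ ℤ.< lead f) fs →
  (∀ ℓ → Prime ℓ → Σ ℤ λ n → ¬ ((+ ℓ) ℤD.∣ evalProd fs n)) →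
  ∀ N → Σ ℕ λ n → (N ℕ.< n) × (1 ℕ.≤ n) × All (λ f → IsPrimeℤ (eval f (+ n))) fs

{-# OPTIONS --safe #-}
module Submission where

-- The values of f₁(x) = ((x + 1)⁵ − 1)/x are the repunits 11111 in base x + 1, which are
-- Brazilian, and f₂ = 2 f₁ + 1 supplies their Sophie Germain partners. Both polynomials are
-- irreducible: f₁ by Eisenstein at 5, f₂ by Eisenstein at 2 for its reversal (f₂ ≡ 1 mod 2 and
-- its leading coefficient is 2). Since f₁(−1) f₂(−1) = 3 and f₁(0) f₂(0) = 55, the product has
-- no fixed prime divisor, so Hypothesis H makes f₁(n) and f₂(n) prime for infinitely many n.
-- Both criteria come from reducing a factorisation f = g h modulo a prime ideal of ℤ: the
-- degrees (and the orders) of the reductions of g and h add up to that of f.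

open import Data.Nat as ℕ using (ℕ; zero; suc; z≤n; s≤s; _<_; _^_; NonZero)
import Data.Nat.Properties as ℕ
import Data.Nat.Divisibility as ℕᵈ
open import Data.Nat.Primality using (Prime; prime?; ¬prime[1]; prime⇒irreducible; euclidsLemma)
open import Data.Nat.Tactic.RingSolver using () renaming (solve-∀ to ℕ-solve)
open import Data.Integer using (ℤ; +_; -[1+_]; 0ℤ; 1ℤ; -1ℤ; _+_; _*_; _≟_; +<+)
import Data.Integer as ℤ
import Data.Integer.Properties as ℤₚ
import Data.Integer.Divisibility as ℤᵘ
open import Data.Integer.Divisibility.Signed
  using (_∣_; divides; _∣?_; ∣-trans; ∣m∣n⇒∣m+n; ∣m∣n⇒∣m-n; ∣n⇒∣m*n; *-monoʳ-∣; *-monoˡ-∣; ∣⇒∣ᵤ; ∣ᵤ⇒∣)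
open import Data.Integer.Tactic.RingSolver using () renaming (solve-∀ to ℤ-solve)
open import Data.List using (List; []; _∷_; map; length)
open import Data.List.Relation.Unary.All using ([]; _∷_)
open import Data.Product using (Σ; ∃; ∃₂; _×_; _,_; proj₂)
open import Data.Sum using (_⊎_; inj₁; inj₂; [_,_]′)
open import Function using (_∘_)
open import Level using (0ℓ)
open import Relation.Binary.Definitions using (tri<; tri≈; tri>)
open import Relation.Binary.PropositionalEquality
open import Relation.Nullary using (¬_; yes; no; contradiction)
open import Relation.Nullary.Decidable using (from-yes; from-no)
open import Relation.Unary using (Pred; Decidable; _∈_; _∉_)

open import Defs

coeff-+ₚ : ∀ f g i → coeff (f +ₚ g) i ≡ coeff f i + coeff g i
coeff-+ₚ []      g       i       = sym (ℤₚ.+-identityˡ _)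
coeff-+ₚ (a ∷ f) []      i       = sym (ℤₚ.+-identityʳ _)
coeff-+ₚ (a ∷ f) (b ∷ g) zero    = refl
coeff-+ₚ (a ∷ f) (b ∷ g) (suc i) = coeff-+ₚ f g i

coeff-map-* : ∀ a g i → coeff (map (a *_) g) i ≡ a * coeff g i
coeff-map-* a []      i       = sym (ℤₚ.*-zeroʳ a)
coeff-map-* a (b ∷ g) zero    = refl
coeff-map-* a (b ∷ g) (suc i) = coeff-map-* a g i

coeff-∷*ₚ : ∀ a g h k → coeff ((a ∷ g) *ₚ h) k ≡ a * coeff h k + coeff (0ℤ ∷ g *ₚ h) k
coeff-∷*ₚ a g h k =
  trans (coeff-+ₚ (map (a *_) h) _ k) (cong (_+ coeff (0ℤ ∷ g *ₚ h) k) (coeff-map-* a h k))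

coeff-*ₚ[] : ∀ g k → coeff (g *ₚ []) k ≡ 0ℤ
coeff-*ₚ[] []      k       = refl
coeff-*ₚ[] (a ∷ g) zero    = refl
coeff-*ₚ[] (a ∷ g) (suc k) = coeff-*ₚ[] g k

coeff-*ₚ∷ : ∀ g b h k → coeff (g *ₚ (b ∷ h)) k ≡ coeff g k * b + coeff (0ℤ ∷ g *ₚ h) k
coeff-*ₚ∷ []      b h zero    = refl
coeff-*ₚ∷ []      b h (suc k) = refl
coeff-*ₚ∷ (a ∷ g) b h zero    = coeff-∷*ₚ a g (b ∷ h) zero
coeff-*ₚ∷ (a ∷ g) b h (suc k) = begin
  coeff ((a ∷ g) *ₚ (b ∷ h)) (suc k)                      ≡⟨ coeff-∷*ₚ a g (b ∷ h) (suc k) ⟩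
  a * coeff h k + coeff (g *ₚ (b ∷ h)) k                ≡⟨ cong (_+_ (a * coeff h k)) (coeff-*ₚ∷ g b h k) ⟩
  a * coeff h k + (coeff g k * b + coeff (0ℤ ∷ g *ₚ h) k) ≡⟨ swap (a * coeff h k) (coeff g k * b) _ ⟩
  coeff g k * b + (a * coeff h k + coeff (0ℤ ∷ g *ₚ h) k) ≡⟨ cong (_+_ (coeff g k * b)) (sym (coeff-∷*ₚ a g h k)) ⟩
  coeff g k * b + coeff ((a ∷ g) *ₚ h) k                  ∎
  where
  open ≡-Reasoning
  swap : ∀ x y z → x + (y + z) ≡ y + (x + z)
  swap = ℤ-solve

∷-cong : ∀ a {p q} → p ≈ₚ q → (a ∷ p) ≈ₚ (a ∷ q)
∷-cong a p≈q zero    = refl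
∷-cong a p≈q (suc i) = p≈q i

*ₚ-comm : ∀ g h → (g *ₚ h) ≈ₚ (h *ₚ g)
*ₚ-comm []      h k = sym (coeff-*ₚ[] h k)
*ₚ-comm (a ∷ g) h k = begin
  coeff ((a ∷ g) *ₚ h) k                   ≡⟨ coeff-∷*ₚ a g h k ⟩
  a * coeff h k + coeff (0ℤ ∷ g *ₚ h) k     ≡⟨ cong₂ _+_ (ℤₚ.*-comm a (coeff h k)) (∷-cong 0ℤ (*ₚ-comm g h) k) ⟩
  coeff h k * a + coeff (0ℤ ∷ h *ₚ g) k     ≡⟨ sym (coeff-*ₚ∷ h a g k) ⟩
  coeff (h *ₚ (a ∷ g)) k                   ∎
  where open ≡-Reasoning

factorisation-comm : ∀ {f} g h → f ≈ₚ (g *ₚ h) → f ≈ₚ (h *ₚ g)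
factorisation-comm g h f≈gh i = trans (f≈gh i) (*ₚ-comm g h i)

record DecPrimeIdeal : Set₁ where
  field
    𝔭         : Pred ℤ 0ℓ
    0∈𝔭       : 0ℤ ∈ 𝔭
    +-closed  : ∀ {x y} → x ∈ 𝔭 → y ∈ 𝔭 → x + y ∈ 𝔭
    *-closedˡ : ∀ x {y} → y ∈ 𝔭 → x * y ∈ 𝔭
    prime     : ∀ x y → x * y ∈ 𝔭 → x ∈ 𝔭 ⊎ y ∈ 𝔭
    _∈𝔭?      : Decidable 𝔭

module Reduction (I : DecPrimeIdeal) where
  open DecPrimeIdeal I

  *-closedʳ : ∀ {x} y → x ∈ 𝔭 → x * y ∈ 𝔭
  *-closedʳ {x} y x∈𝔭 = subst (_∈ 𝔭) (ℤₚ.*-comm y x) (*-closedˡ y x∈𝔭)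

  ∈-cancelʳ : ∀ {x y} → x + y ∈ 𝔭 → y ∈ 𝔭 → x ∈ 𝔭
  ∈-cancelʳ {x} {y} x+y∈𝔭 y∈𝔭 =
    subst (_∈ 𝔭) (x+y-y≡x x y) (+-closed x+y∈𝔭 (*-closedˡ -1ℤ y∈𝔭))
    where
    x+y-y≡x : ∀ x y → (x + y) + -1ℤ * y ≡ x
    x+y-y≡x = ℤ-solve

  ∉-+ʳ : ∀ {x y} → x ∉ 𝔭 → y ∈ 𝔭 → x + y ∉ 𝔭
  ∉-+ʳ x∉𝔭 y∈𝔭 x+y∈𝔭 = x∉𝔭 (∈-cancelʳ x+y∈𝔭 y∈𝔭)

  ∉-+ˡ : ∀ {x y} → x ∈ 𝔭 → y ∉ 𝔭 → x + y ∉ 𝔭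
  ∉-+ˡ {x} {y} x∈𝔭 y∉𝔭 = ∉-+ʳ y∉𝔭 x∈𝔭 ∘ subst (_∈ 𝔭) (ℤₚ.+-comm x y)

  ∉-* : ∀ {x y} → x ∉ 𝔭 → y ∉ 𝔭 → x * y ∉ 𝔭
  ∉-* {x} {y} x∉𝔭 y∉𝔭 = [ x∉𝔭 , y∉𝔭 ]′ ∘ prime x y

  ∉𝔭⇒≢0 : ∀ {x} → x ∉ 𝔭 → x ≢ 0ℤ
  ∉𝔭⇒≢0 x∉𝔭 refl = x∉𝔭 0∈𝔭

  Vanishes : Poly → Set
  Vanishes g = ∀ i → coeff g i ∈ 𝔭

  VanishesAbove : Poly → ℕ → Set
  VanishesAbove g d = ∀ i → d ℕ.< i → coeff g i ∈ 𝔭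

  VanishesBelow : Poly → ℕ → Set
  VanishesBelow g d = ∀ i → i ℕ.< d → coeff g i ∈ 𝔭

  record Degree (g : Poly) (d : ℕ) : Set where
    constructor _,_
    field
      coeff∉𝔭 : coeff g d ∉ 𝔭
      above   : VanishesAbove g d

  record Order (g : Poly) (d : ℕ) : Set where
    constructor _,_
    field
      coeff∉𝔭 : coeff g d ∉ 𝔭
      below   : VanishesBelow g d

  vanishes-0∷ : ∀ {g} → Vanishes g → Vanishes (0ℤ ∷ g)
  vanishes-0∷ g≡0 zero    = 0∈𝔭
  vanishes-0∷ g≡0 (suc i) = g≡0 i

  vanishesBelow-0∷ : ∀ {g e} → VanishesBelow g e → VanishesBelow (0ℤ ∷ g) (suc e)
  vanishesBelow-0∷ g≡0 zero    _         = 0∈𝔭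
  vanishesBelow-0∷ g≡0 (suc i) (s≤s i<e) = g≡0 i i<e

  degree-∷ : ∀ {a g d} → Degree (a ∷ g) (suc d) → Degree g d
  degree-∷ (gd∉𝔭 , above) = gd∉𝔭 , λ i d<i → above (suc i) (s≤s d<i)

  order-∷ : ∀ {a g d} → Order (a ∷ g) (suc d) → Order g d
  order-∷ (gd∉𝔭 , below) = gd∉𝔭 , λ i i<d → below (suc i) (s≤s i<d)

  vanishes-*ₚˡ : ∀ g h → Vanishes g → Vanishes (g *ₚ h)
  vanishes-*ₚˡ []      h g≡0 i = 0∈𝔭
  vanishes-*ₚˡ (a ∷ g) h g≡0 i rewrite coeff-∷*ₚ a g h i =
    +-closed (*-closedʳ (coeff h i) (g≡0 0)) (vanishes-0∷ (vanishes-*ₚˡ g h (g≡0 ∘ suc)) i)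

  vanishes-*ₚʳ : ∀ g h → Vanishes h → Vanishes (g *ₚ h)
  vanishes-*ₚʳ g h h≡0 i = subst (_∈ 𝔭) (*ₚ-comm h g i) (vanishes-*ₚˡ h g h≡0 i)

  vanishesBelow-*ₚ : ∀ g h {e} → VanishesBelow h e → VanishesBelow (g *ₚ h) e
  vanishesBelow-*ₚ []      h h≡0 i i<e = 0∈𝔭
  vanishesBelow-*ₚ (a ∷ g) h h≡0 i i<e rewrite coeff-∷*ₚ a g h i =
    +-closed (*-closedˡ a (h≡0 i i<e))
             (vanishesBelow-0∷ (vanishesBelow-*ₚ g h h≡0) i (ℕ.m<n⇒m<1+n i<e))

  degree-*ₚ : ∀ {g h d e} → Degree g d → Degree h e → Degree (g *ₚ h) (d ℕ.+ e)
  degree-*ₚ {[]}    (0∉𝔭 , _) _ = contradiction 0∈𝔭 0∉𝔭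
  degree-*ₚ {a ∷ g} {h} {zero} {e} (a∉𝔭 , g-above) (hₑ∉𝔭 , h-above) = top∉𝔭 , above
    where
    gh≡0 : Vanishes (0ℤ ∷ g *ₚ h)
    gh≡0 = vanishes-0∷ (vanishes-*ₚˡ g h (λ i → g-above (suc i) (s≤s z≤n)))
    top∉𝔭 : coeff ((a ∷ g) *ₚ h) e ∉ 𝔭
    top∉𝔭 rewrite coeff-∷*ₚ a g h e = ∉-+ʳ (∉-* a∉𝔭 hₑ∉𝔭) (gh≡0 e)
    above : VanishesAbove ((a ∷ g) *ₚ h) e
    above i e<i rewrite coeff-∷*ₚ a g h i = +-closed (*-closedˡ a (h-above i e<i)) (gh≡0 i)
  degree-*ₚ {a ∷ g} {h} {suc d} {e} deg-g deg-h@(_ , h-above) = top∉𝔭 , above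
    where
    deg-gh : Degree (g *ₚ h) (d ℕ.+ e)
    deg-gh = degree-*ₚ (degree-∷ deg-g) deg-h
    e<1+d+e : e ℕ.< suc (d ℕ.+ e)
    e<1+d+e = s≤s (ℕ.m≤n+m e d)
    top∉𝔭 : coeff ((a ∷ g) *ₚ h) (suc (d ℕ.+ e)) ∉ 𝔭
    top∉𝔭 rewrite coeff-∷*ₚ a g h (suc (d ℕ.+ e)) =
      ∉-+ˡ (*-closedˡ a (h-above _ e<1+d+e)) (Degree.coeff∉𝔭 deg-gh)
    above : VanishesAbove ((a ∷ g) *ₚ h) (suc (d ℕ.+ e))
    above (suc i) (s≤s d+e<i) rewrite coeff-∷*ₚ a g h (suc i) =
      +-closed (*-closedˡ a (h-above (suc i) (ℕ.<-trans e<1+d+e (s≤s d+e<i))))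
               (Degree.above deg-gh i d+e<i)

  order-*ₚ : ∀ {g h d e} → Order g d → Order h e → Order (g *ₚ h) (d ℕ.+ e)
  order-*ₚ {[]}    (0∉𝔭 , _) _ = contradiction 0∈𝔭 0∉𝔭
  order-*ₚ {a ∷ g} {h} {zero} {e} (a∉𝔭 , _) (hₑ∉𝔭 , h-below) = bottom∉𝔭 , below
    where
    gh-below : VanishesBelow (0ℤ ∷ g *ₚ h) (suc e)
    gh-below = vanishesBelow-0∷ (vanishesBelow-*ₚ g h h-below)
    bottom∉𝔭 : coeff ((a ∷ g) *ₚ h) e ∉ 𝔭
    bottom∉𝔭 rewrite coeff-∷*ₚ a g h e = ∉-+ʳ (∉-* a∉𝔭 hₑ∉𝔭) (gh-below e ℕ.≤-refl)
    below : VanishesBelow ((a ∷ g) *ₚ h) e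
    below i i<e rewrite coeff-∷*ₚ a g h i =
      +-closed (*-closedˡ a (h-below i i<e)) (gh-below i (ℕ.m<n⇒m<1+n i<e))
  order-*ₚ {a ∷ g} {h} {suc d} {e} ord-g@(_ , g-below) ord-h = bottom∉𝔭 , below
    where
    a∈𝔭 : a ∈ 𝔭
    a∈𝔭 = g-below 0 (s≤s z≤n)
    ord-gh : Order (g *ₚ h) (d ℕ.+ e)
    ord-gh = order-*ₚ (order-∷ ord-g) ord-h
    bottom∉𝔭 : coeff ((a ∷ g) *ₚ h) (suc (d ℕ.+ e)) ∉ 𝔭
    bottom∉𝔭 rewrite coeff-∷*ₚ a g h (suc (d ℕ.+ e)) =
      ∉-+ˡ (*-closedʳ _ a∈𝔭) (Order.coeff∉𝔭 ord-gh)
    below : VanishesBelow ((a ∷ g) *ₚ h) (suc (d ℕ.+ e))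
    below zero    _         rewrite coeff-∷*ₚ a g h zero    =
      +-closed (*-closedʳ _ a∈𝔭) 0∈𝔭
    below (suc i) (s≤s i<d) rewrite coeff-∷*ₚ a g h (suc i) =
      +-closed (*-closedʳ _ a∈𝔭) (Order.below ord-gh i i<d)

  vanishes⊎degree : ∀ g → Vanishes g ⊎ ∃ (Degree g)
  vanishes⊎degree []      = inj₁ (λ _ → 0∈𝔭)
  vanishes⊎degree (a ∷ g) with vanishes⊎degree g
  ... | inj₂ (d , gd∉𝔭 , g-above) = inj₂ (suc d , gd∉𝔭 , above)
    where
    above : VanishesAbove (a ∷ g) (suc d)
    above (suc i) (s≤s d<i) = g-above i d<i
  ... | inj₁ g≡0 with a ∈𝔭?
  ...   | yes a∈𝔭 = inj₁ λ { zero → a∈𝔭 ; (suc i) → g≡0 i }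
  ...   | no  a∉𝔭 = inj₂ (0 , a∉𝔭 , λ { (suc i) _ → g≡0 i })

  vanishes⊎order : ∀ g → Vanishes g ⊎ ∃ (Order g)
  vanishes⊎order []      = inj₁ (λ _ → 0∈𝔭)
  vanishes⊎order (a ∷ g) with a ∈𝔭?
  ... | no  a∉𝔭 = inj₂ (0 , a∉𝔭 , λ _ ())
  ... | yes a∈𝔭 with vanishes⊎order g
  ...   | inj₁ g≡0 = inj₁ λ { zero → a∈𝔭 ; (suc i) → g≡0 i }
  ...   | inj₂ (d , gd∉𝔭 , g-below) = inj₂ (suc d , gd∉𝔭 , below)
    where
    below : VanishesBelow (a ∷ g) (suc d)
    below zero    _         = a∈𝔭
    below (suc i) (s≤s i<d) = g-below i i<d

  degree-unique : ∀ {g d e} → Degree g d → Degree g e → d ≡ e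
  degree-unique {d = d} {e} (gd∉𝔭 , g-above-d) (ge∉𝔭 , g-above-e) with ℕ.<-cmp d e
  ... | tri< d<e _ _ = contradiction (g-above-d e d<e) ge∉𝔭
  ... | tri≈ _ d≡e _ = d≡e
  ... | tri> _ _ e<d = contradiction (g-above-e d e<d) gd∉𝔭

  order-unique : ∀ {g d e} → Order g d → Order g e → d ≡ e
  order-unique {d = d} {e} (gd∉𝔭 , g-below-d) (ge∉𝔭 , g-below-e) with ℕ.<-cmp d e
  ... | tri< d<e _ _ = contradiction (g-below-e d d<e) gd∉𝔭
  ... | tri≈ _ d≡e _ = d≡e
  ... | tri> _ _ e<d = contradiction (g-below-d e e<d) ge∉𝔭

  ≤-degree : ∀ {g d i} → Degree g d → coeff g i ∉ 𝔭 → i ℕ.≤ d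
  ≤-degree {d = d} {i} (_ , g-above) gi∉𝔭 with ℕ.≤-<-connex i d
  ... | inj₁ i≤d = i≤d
  ... | inj₂ d<i = contradiction (g-above i d<i) gi∉𝔭

  degree-resp-≈ : ∀ {f g d} → f ≈ₚ g → Degree f d → Degree g d
  degree-resp-≈ {d = d} f≈g (fd∉𝔭 , f-above) =
    fd∉𝔭 ∘ subst (_∈ 𝔭) (sym (f≈g d)) , λ i d<i → subst (_∈ 𝔭) (f≈g i) (f-above i d<i)

  order-resp-≈ : ∀ {f g d} → f ≈ₚ g → Order f d → Order g d
  order-resp-≈ {d = d} f≈g (fd∉𝔭 , f-below) =
    fd∉𝔭 ∘ subst (_∈ 𝔭) (sym (f≈g d)) , λ i i<d → subst (_∈ 𝔭) (f≈g i) (f-below i i<d)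

  factor-nonvanishing : ∀ g h {f n} → f ≈ₚ (g *ₚ h) → coeff f n ∉ 𝔭 → ¬ Vanishes g × ¬ Vanishes h
  factor-nonvanishing g h {n = n} f≈gh fn∉𝔭 =
    (λ g≡0 → fn∉𝔭 (subst (_∈ 𝔭) (sym (f≈gh n)) (vanishes-*ₚˡ g h g≡0 n))) ,
    (λ h≡0 → fn∉𝔭 (subst (_∈ 𝔭) (sym (f≈gh n)) (vanishes-*ₚʳ g h h≡0 n)))

  degree-split : ∀ g h {f n} → f ≈ₚ (g *ₚ h) → Degree f n →
                 ∃₂ λ d e → Degree g d × Degree h e × d ℕ.+ e ≡ n
  degree-split g h {f} f≈gh deg-f@(fn∉𝔭 , _)
    with factor-nonvanishing g h {f} f≈gh fn∉𝔭 | vanishes⊎degree g | vanishes⊎degree h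
  ... | g≢0 , _   | inj₁ g≡0 | _ = contradiction g≡0 g≢0
  ... | _   , h≢0 | _ | inj₁ h≡0 = contradiction h≡0 h≢0
  ... | _ | inj₂ (d , deg-g) | inj₂ (e , deg-h) =
    d , e , deg-g , deg-h , degree-unique (degree-*ₚ deg-g deg-h) (degree-resp-≈ f≈gh deg-f)

  order-split : ∀ g h {f n} → f ≈ₚ (g *ₚ h) → Order f n →
                ∃₂ λ d e → Order g d × Order h e × d ℕ.+ e ≡ n
  order-split g h {f} f≈gh ord-f@(fn∉𝔭 , _)
    with factor-nonvanishing g h {f} f≈gh fn∉𝔭 | vanishes⊎order g | vanishes⊎order h
  ... | g≢0 , _   | inj₁ g≡0 | _ = contradiction g≡0 g≢0
  ... | _   , h≢0 | _ | inj₁ h≡0 = contradiction h≡0 h≢0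
  ... | _ | inj₂ (d , ord-g) | inj₂ (e , ord-h) =
    d , e , ord-g , ord-h , order-unique (order-*ₚ ord-g ord-h) (order-resp-≈ f≈gh ord-f)

zeroIdeal : DecPrimeIdeal
zeroIdeal = record
  { 𝔭         = _≡ 0ℤ
  ; 0∈𝔭       = refl
  ; +-closed  = cong₂ _+_
  ; *-closedˡ = λ x y≡0 → trans (cong (x *_) y≡0) (ℤₚ.*-zeroʳ x)
  ; prime     = λ x y xy≡0 → ℤₚ.i*j≡0⇒i≡0∨j≡0 x xy≡0
  ; _∈𝔭?      = _≟ 0ℤ
  }

multiplesOf : ∀ p → Prime p → DecPrimeIdeal
multiplesOf p p-prime = record
  { 𝔭         = + p ∣_
  ; 0∈𝔭       = divides 0ℤ refl
  ; +-closed  = ∣m∣n⇒∣m+n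
  ; *-closedˡ = ∣n⇒∣m*n
  ; prime     = euclid
  ; _∈𝔭?      = + p ∣?_
  }
  where
  euclid : ∀ x y → + p ∣ x * y → + p ∣ x ⊎ + p ∣ y
  euclid x y p∣xy
    with euclidsLemma ℤ.∣ x ∣ ℤ.∣ y ∣ p-prime (subst (p ℕᵈ.∣_) (ℤₚ.abs-* x y) (∣⇒∣ᵤ p∣xy))
  ... | inj₁ p∣x = inj₁ (∣ᵤ⇒∣ p∣x)
  ... | inj₂ p∣y = inj₂ (∣ᵤ⇒∣ p∣y)

module ℤ[x] = Reduction zeroIdeal

IsConstant : Poly → Set
IsConstant g = ∀ i → coeff g (suc i) ≡ 0ℤ

degree0⇒isConstant : ∀ {g} → ℤ[x].Degree g 0 → IsConstant g
degree0⇒isConstant deg i = ℤ[x].Degree.above deg (suc i) (s≤s z≤n)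

coeff-*ₚ-0 : ∀ g h → coeff (g *ₚ h) 0 ≡ coeff g 0 * coeff h 0
coeff-*ₚ-0 []      h = refl
coeff-*ₚ-0 (a ∷ g) h = trans (coeff-∷*ₚ a g h 0) (ℤₚ.+-identityʳ _)

coeff-isConstant-*ₚ : ∀ g h → IsConstant g → ∀ k → coeff (g *ₚ h) k ≡ coeff g 0 * coeff h k
coeff-isConstant-*ₚ []      h _       k = refl
coeff-isConstant-*ₚ (a ∷ g) h g-const k = begin
  coeff ((a ∷ g) *ₚ h) k                 ≡⟨ coeff-∷*ₚ a g h k ⟩
  a * coeff h k + coeff (0ℤ ∷ g *ₚ h) k
    ≡⟨ cong (_+_ (a * coeff h k)) (ℤ[x].vanishes-0∷ (ℤ[x].vanishes-*ₚˡ g h g-const) k) ⟩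
  a * coeff h k + 0ℤ                     ≡⟨ ℤₚ.+-identityʳ _ ⟩
  a * coeff h k                          ∎
  where open ≡-Reasoning

coeff-*ₚ-degree : ∀ {g h d e} → ℤ[x].Degree g d → ℤ[x].Degree h e →
                  coeff (g *ₚ h) (d ℕ.+ e) ≡ coeff g d * coeff h e
coeff-*ₚ-degree {[]}                   _     _     = refl
coeff-*ₚ-degree {a ∷ g} {h} {zero} {e} deg-g _ = coeff-isConstant-*ₚ (a ∷ g) h (degree0⇒isConstant deg-g) e
coeff-*ₚ-degree {a ∷ g} {h} {suc d} {e} deg-g deg-h = begin
  coeff ((a ∷ g) *ₚ h) (suc (d ℕ.+ e))          ≡⟨ coeff-∷*ₚ a g h (suc (d ℕ.+ e)) ⟩
  a * coeff h (suc (d ℕ.+ e)) + coeff (g *ₚ h) (d ℕ.+ e)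
    ≡⟨ cong₂ _+_ (cong (a *_) (ℤ[x].Degree.above deg-h _ (s≤s (ℕ.m≤n+m e d))))
                 (coeff-*ₚ-degree (ℤ[x].degree-∷ deg-g) deg-h) ⟩
  a * 0ℤ + coeff g d * coeff h e                ≡⟨ cong (_+ coeff g d * coeff h e) (ℤₚ.*-zeroʳ a) ⟩
  0ℤ + coeff g d * coeff h e                    ≡⟨ ℤₚ.+-identityˡ _ ⟩
  coeff g d * coeff h e                         ∎
  where open ≡-Reasoning

∣∣≡1⇒unit : ∀ c → ℤ.∣ c ∣ ≡ 1 → c ≡ 1ℤ ⊎ c ≡ -1ℤ
∣∣≡1⇒unit (+ _)    refl = inj₁ refl
∣∣≡1⇒unit -[1+ _ ] refl = inj₂ refl

∣1⇒unit : ∀ {c} → c ∣ 1ℤ → c ≡ 1ℤ ⊎ c ≡ -1ℤ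
∣1⇒unit {c} c∣1 = ∣∣≡1⇒unit c (ℕᵈ.∣1⇒≡1 (∣⇒∣ᵤ c∣1))

Primitive : Poly → Set
Primitive f = ∀ c → (∀ i → c ∣ coeff f i) → c ≡ 1ℤ ⊎ c ≡ -1ℤ

constant-factor⇒isUnit : ∀ {f} g h → Primitive f → f ≈ₚ (g *ₚ h) → IsConstant g → IsUnitPoly g
constant-factor⇒isUnit {f} g h prim f≈gh g-const = prim (coeff g 0) g₀∣f , g-const
  where
  g₀∣f : ∀ i → coeff g 0 ∣ _
  g₀∣f i = divides (coeff h i)
    (trans (f≈gh i) (trans (coeff-isConstant-*ₚ g h g-const i) (ℤₚ.*-comm (coeff g 0) (coeff h i))))

isConstant-cofactor : ∀ g h {f n} → f ≈ₚ (g *ₚ h) → ℤ[x].Degree f n → coeff h n ≢ 0ℤ → IsConstant g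
isConstant-cofactor g h f≈gh deg-f hₙ≢0 with ℤ[x].degree-split g h f≈gh deg-f
... | d , e , deg-g , deg-h , d+e≡n = degree0⇒isConstant (subst (ℤ[x].Degree g) d≡0 deg-g)
  where
  d≡0 : d ≡ 0
  d≡0 = ℕ.n≤0⇒n≡0 (ℕ.+-cancelʳ-≤ e d 0 (subst (ℕ._≤ e) (sym d+e≡n) (ℤ[x].≤-degree deg-h hₙ≢0)))

irreducible-intro : ∀ {f n} → ℤ[x].Degree f n → 0 ℕ.< n →
                    (∀ g h → f ≈ₚ (g *ₚ h) → IsUnitPoly g ⊎ IsUnitPoly h) → Irreducible f
irreducible-intro {f} {suc m} deg-f (s≤s z≤n) factor =
  (λ f≡0 → fₙ≢0 (f≡0 (suc m))) , (λ f-unit → fₙ≢0 (proj₂ f-unit m)) , factor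
  where
  fₙ≢0 : coeff f (suc m) ≢ 0ℤ
  fₙ≢0 = ℤ[x].Degree.coeff∉𝔭 deg-f

∣-*-∣ : ∀ {k l x y} → k ∣ x → l ∣ y → k * l ∣ x * y
∣-*-∣ {k} {l} {x} {y} k∣x l∣y = ∣-trans (*-monoʳ-∣ k l∣y) (*-monoˡ-∣ y k∣x)

eisenstein : ∀ {f n} p → Prime p → Primitive f → ℤ[x].Degree f n → 0 ℕ.< n →
             ¬ (+ p ∣ coeff f n) → (∀ i → i ℕ.< n → + p ∣ coeff f i) →
             ¬ (+ p * + p ∣ coeff f 0) → Irreducible f
eisenstein {f} {n} p p-prime prim deg-f 0<n p∤fₙ p∣lower p²∤f₀ =
  irreducible-intro deg-f 0<n factor
  where
  module 𝔽ₚ[x] = Reduction (multiplesOf p p-prime)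

  cofactor-of-order-n⇒isUnit : ∀ g h → f ≈ₚ (g *ₚ h) → 𝔽ₚ[x].Order h n → IsUnitPoly g
  cofactor-of-order-n⇒isUnit g h f≈gh ord-h = constant-factor⇒isUnit {f} g h prim f≈gh
    (isConstant-cofactor g h {f} f≈gh deg-f (𝔽ₚ[x].∉𝔭⇒≢0 (𝔽ₚ[x].Order.coeff∉𝔭 ord-h)))

  factor : ∀ g h → f ≈ₚ (g *ₚ h) → IsUnitPoly g ⊎ IsUnitPoly h
  factor g h f≈gh with 𝔽ₚ[x].order-split g h {f} f≈gh (p∤fₙ 𝔽ₚ[x]., p∣lower)
  ... | zero , e , _ , ord-h , refl = inj₁ (cofactor-of-order-n⇒isUnit g h f≈gh ord-h)
  ... | suc d , zero , ord-g , _ , d+0≡n =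
    inj₂ (cofactor-of-order-n⇒isUnit h g (factorisation-comm {f} g h f≈gh)
            (subst (𝔽ₚ[x].Order g) (trans (sym (ℕ.+-identityʳ _)) d+0≡n) ord-g))
  ... | suc _ , suc _ , ord-g , ord-h , _ = contradiction p²∣f₀ p²∤f₀
    where
    p²∣f₀ : + p * + p ∣ coeff f 0
    p²∣f₀ = subst (+ p * + p ∣_) (sym (trans (f≈gh 0) (coeff-*ₚ-0 g h)))
      (∣-*-∣ (𝔽ₚ[x].Order.below ord-g 0 (s≤s z≤n)) (𝔽ₚ[x].Order.below ord-h 0 (s≤s z≤n)))

eisenstein-reversed : ∀ {f n} p → Prime p → Primitive f → ℤ[x].Degree f n → 0 ℕ.< n →
                      ¬ (+ p ∣ coeff f 0) → (∀ i → 0 ℕ.< i → + p ∣ coeff f i) →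
                      ¬ (+ p * + p ∣ coeff f n) → Irreducible f
eisenstein-reversed {f} {n} p p-prime prim deg-f 0<n p∤f₀ p∣upper p²∤fₙ =
  irreducible-intro deg-f 0<n factor
  where
  module 𝔽ₚ[x] = Reduction (multiplesOf p p-prime)

  factor : ∀ g h → f ≈ₚ (g *ₚ h) → IsUnitPoly g ⊎ IsUnitPoly h
  factor g h f≈gh
    with 𝔽ₚ[x].degree-split g h {f} f≈gh (p∤f₀ 𝔽ₚ[x]., p∣upper) | ℤ[x].degree-split g h f≈gh deg-f
  ... | _ | zero , _ , deg-g , _ , _ =
    inj₁ (constant-factor⇒isUnit {f} g h prim f≈gh (degree0⇒isConstant deg-g))
  ... | _ | suc _ , zero , _ , deg-h , _ =
    inj₂ (constant-factor⇒isUnit {f} h g prim (factorisation-comm {f} g h f≈gh) (degree0⇒isConstant deg-h))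
  ... | dₚ , eₚ , degₚ-g , degₚ-h , dₚ+eₚ≡0 | suc d , suc e , deg-g , deg-h , d+e≡n =
    contradiction p²∣fₙ p²∤fₙ
    where
    p∣g-lead : + p ∣ coeff g (suc d)
    p∣g-lead = 𝔽ₚ[x].Degree.above degₚ-g (suc d)
      (subst (ℕ._< suc d) (sym (ℕ.m+n≡0⇒m≡0 dₚ dₚ+eₚ≡0)) (s≤s z≤n))
    p∣h-lead : + p ∣ coeff h (suc e)
    p∣h-lead = 𝔽ₚ[x].Degree.above degₚ-h (suc e)
      (subst (ℕ._< suc e) (sym (ℕ.m+n≡0⇒n≡0 dₚ dₚ+eₚ≡0)) (s≤s z≤n))
    lead-product : coeff g (suc d) * coeff h (suc e) ≡ coeff f n
    lead-product = begin
      coeff g (suc d) * coeff h (suc e)  ≡⟨ sym (coeff-*ₚ-degree deg-g deg-h) ⟩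
      coeff (g *ₚ h) (suc d ℕ.+ suc e)   ≡⟨ cong (coeff (g *ₚ h)) d+e≡n ⟩
      coeff (g *ₚ h) n                   ≡⟨ sym (f≈gh n) ⟩
      coeff f n                          ∎
      where open ≡-Reasoning
    p²∣fₙ : + p * + p ∣ coeff f n
    p²∣fₙ = subst (+ p * + p ∣_) lead-product (∣-*-∣ p∣g-lead p∣h-lead)

b<repunit∸1 : ∀ b .{{_ : NonZero b}} q → b ℕ.< repunit b (3 ℕ.+ q) ℕ.∸ 1
b<repunit∸1 b q = ℕ.m+n≤o⇒m≤o∸n (suc b)
  (ℕ.+-mono-≤ (ℕ.m^n>0 b (2 ℕ.+ q))
    (ℕ.+-mono-≤ (ℕ.m≤m*n b (b ^ q) {{ℕ.m^n≢0 b q}}) (ℕ.≤-trans (ℕ.m^n>0 b q) (ℕ.m≤m+n _ _))))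

repunit⇒brazilian : ∀ {b q} → 1 ℕ.< b → 3 ℕ.≤ q → Brazilian (repunit b q)
repunit⇒brazilian {b@(suc _)} {q} 1<b (s≤s (s≤s (s≤s {n = q′} _))) =
  b , 1 , q , 1<b , b<repunit∸1 b q′ , ℕ.≤-refl , 1<b , s≤s (s≤s z≤n) , sym (ℕ.*-identityˡ _)

evalℕ : List ℕ → ℕ → ℕ
evalℕ []       x = 0
evalℕ (a ∷ cs) x = a ℕ.+ x ℕ.* evalℕ cs x

eval-map-+ : ∀ cs n → eval (map +_ cs) (+ n) ≡ + evalℕ cs n
eval-map-+ []       n = refl
eval-map-+ (a ∷ cs) n = begin
  + a + + n * eval (map +_ cs) (+ n)  ≡⟨ cong (λ t → + a + + n * t) (eval-map-+ cs n) ⟩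
  + a + + n * + evalℕ cs n            ≡⟨ cong (_+_ (+ a)) (sym (ℤₚ.pos-* n (evalℕ cs n))) ⟩
  + a + + (n ℕ.* evalℕ cs n)          ≡⟨ sym (ℤₚ.pos-+ a _) ⟩
  + evalℕ (a ∷ cs) n                  ∎
  where open ≡-Reasoning

coeff-≥length : ∀ f {i} → length f ℕ.≤ i → coeff f i ≡ 0ℤ
coeff-≥length []      _         = refl
coeff-≥length (a ∷ f) (s≤s len≤i) = coeff-≥length f len≤i

-- ((x + 1)⁵ − 1) / x
repunitPoly : Poly
repunitPoly = map +_ (5 ∷ 10 ∷ 10 ∷ 5 ∷ 1 ∷ [])

sophieGermainPoly : Poly
sophieGermainPoly = map +_ (11 ∷ 20 ∷ 20 ∷ 10 ∷ 2 ∷ [])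

eval-repunitPoly : ∀ n → eval repunitPoly (+ n) ≡ + repunit (suc n) 5
eval-repunitPoly n = trans (eval-map-+ (5 ∷ 10 ∷ 10 ∷ 5 ∷ 1 ∷ []) n) (cong +_ (binomial n))
  where
  binomial : ∀ n → 5 ℕ.+ n ℕ.* (10 ℕ.+ n ℕ.* (10 ℕ.+ n ℕ.* (5 ℕ.+ n ℕ.* (1 ℕ.+ n ℕ.* 0))))
               ≡ (1 ℕ.+ n) ℕ.* ((1 ℕ.+ n) ℕ.* ((1 ℕ.+ n) ℕ.* ((1 ℕ.+ n) ℕ.* 1)))
                 ℕ.+ ((1 ℕ.+ n) ℕ.* ((1 ℕ.+ n) ℕ.* ((1 ℕ.+ n) ℕ.* 1))
                 ℕ.+ ((1 ℕ.+ n) ℕ.* ((1 ℕ.+ n) ℕ.* 1) ℕ.+ ((1 ℕ.+ n) ℕ.* 1 ℕ.+ (1 ℕ.+ 0))))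
  binomial = ℕ-solve

eval-sophieGermainPoly : ∀ n → eval sophieGermainPoly (+ n) ≡ + (2 ℕ.* repunit (suc n) 5 ℕ.+ 1)
eval-sophieGermainPoly n = trans (eval-map-+ (11 ∷ 20 ∷ 20 ∷ 10 ∷ 2 ∷ []) n) (cong +_ (twice+1 n))
  where
  twice+1 : ∀ n → 11 ℕ.+ n ℕ.* (20 ℕ.+ n ℕ.* (20 ℕ.+ n ℕ.* (10 ℕ.+ n ℕ.* (2 ℕ.+ n ℕ.* 0))))
              ≡ 2 ℕ.* ((1 ℕ.+ n) ℕ.* ((1 ℕ.+ n) ℕ.* ((1 ℕ.+ n) ℕ.* ((1 ℕ.+ n) ℕ.* 1)))
                 ℕ.+ ((1 ℕ.+ n) ℕ.* ((1 ℕ.+ n) ℕ.* ((1 ℕ.+ n) ℕ.* 1))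
                 ℕ.+ ((1 ℕ.+ n) ℕ.* ((1 ℕ.+ n) ℕ.* 1) ℕ.+ ((1 ℕ.+ n) ℕ.* 1 ℕ.+ (1 ℕ.+ 0))))) ℕ.+ 1
  twice+1 = ℕ-solve

repunitPoly-irreducible : Irreducible repunitPoly
repunitPoly-irreducible =
  eisenstein 5 (from-yes (prime? 5)) isPrimitive degree (s≤s z≤n)
    (from-no (+ 5 ∣? + 1)) lower (from-no (+ 5 * + 5 ∣? + 5))
  where
  isPrimitive : Primitive repunitPoly
  isPrimitive c c∣coeff = ∣1⇒unit (c∣coeff 4)
  degree : ℤ[x].Degree repunitPoly 4
  degree = (λ ()) ℤ[x]., λ i 4<i → coeff-≥length repunitPoly 4<i
  lower : ∀ i → i ℕ.< 4 → + 5 ∣ coeff repunitPoly i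
  lower 0 _ = from-yes (+ 5 ∣? + 5)
  lower 1 _ = from-yes (+ 5 ∣? + 10)
  lower 2 _ = from-yes (+ 5 ∣? + 10)
  lower 3 _ = from-yes (+ 5 ∣? + 5)
  lower (suc (suc (suc (suc _)))) (s≤s (s≤s (s≤s (s≤s ()))))

sophieGermainPoly-irreducible : Irreducible sophieGermainPoly
sophieGermainPoly-irreducible =
  eisenstein-reversed 2 (from-yes (prime? 2)) isPrimitive degree (s≤s z≤n)
    (from-no (+ 2 ∣? + 11)) upper (from-no (+ 2 * + 2 ∣? + 2))
  where
  isPrimitive : Primitive sophieGermainPoly
  isPrimitive c c∣coeff = ∣1⇒unit (∣m∣n⇒∣m-n (c∣coeff 0) (∣n⇒∣m*n (+ 5) (c∣coeff 4)))  -- 11 − 5 · 2 = 1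
  degree : ℤ[x].Degree sophieGermainPoly 4
  degree = (λ ()) ℤ[x]., λ i 4<i → coeff-≥length sophieGermainPoly 4<i
  upper : ∀ i → 0 ℕ.< i → + 2 ∣ coeff sophieGermainPoly i
  upper 1 _ = from-yes (+ 2 ∣? + 20)
  upper 2 _ = from-yes (+ 2 ∣? + 20)
  upper 3 _ = from-yes (+ 2 ∣? + 10)
  upper 4 _ = from-yes (+ 2 ∣? + 2)
  upper (suc (suc (suc (suc (suc _))))) _ = divides 0ℤ refl

noFixedPrimeDivisor : ∀ ℓ → Prime ℓ →
  Σ ℤ λ x → ¬ (+ ℓ ℤᵘ.∣ evalProd (repunitPoly ∷ sophieGermainPoly ∷ []) x)
noFixedPrimeDivisor ℓ ℓ-prime with ℓ ℕ.≟ 3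
... | yes refl = 0ℤ , from-no (3 ℕᵈ.∣? 55)
... | no ℓ≢3   = -1ℤ , ℓ∤3
  where
  ℓ∤3 : ¬ (ℓ ℕᵈ.∣ 3)
  ℓ∤3 ℓ∣3 with prime⇒irreducible (from-yes (prime? 3)) ℓ∣3
  ... | inj₁ refl = ¬prime[1] ℓ-prime
  ... | inj₂ ℓ≡3  = ℓ≢3 ℓ≡3

isPrimeℤ⇒prime : ∀ {m} → IsPrimeℤ (+ m) → Prime m
isPrimeℤ⇒prime (_ , refl , m-prime) = m-prime

proposition6 : HypothesisH →
    (N : ℕ) → Σ ℕ λ p → (N < p) × BrazilianPrime p × SophieGermainPrime p
proposition6 H N
  with H (repunitPoly ∷ sophieGermainPoly ∷ [])
         (repunitPoly-irreducible ∷ sophieGermainPoly-irreducible ∷ [])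
         (+<+ (s≤s z≤n) ∷ +<+ (s≤s z≤n) ∷ []) noFixedPrimeDivisor N
... | n , N<n , 1≤n , R-primeℤ ∷ 2R+1-primeℤ ∷ [] =
  R , N<R , (repunit⇒brazilian {q = 5} (s≤s 1≤n) (s≤s (s≤s (s≤s z≤n))) , R-prime) , R-prime , 2R+1-prime
  where
  R : ℕ
  R = repunit (suc n) 5
  R-prime : Prime R
  R-prime = isPrimeℤ⇒prime (subst IsPrimeℤ (eval-repunitPoly n) R-primeℤ)
  2R+1-prime : Prime (2 ℕ.* R ℕ.+ 1)
  2R+1-prime = isPrimeℤ⇒prime (subst IsPrimeℤ (eval-sophieGermainPoly n) 2R+1-primeℤ)
  N<R : N < R
  N<R = ℕ.<-trans N<n (ℕ.<-trans (ℕ.n<1+n n)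
          (ℕ.<-≤-trans (b<repunit∸1 (suc n) 2) (ℕ.m∸n≤m R 1)))
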